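{- Let $V$ be a set with $|V| = n \ge 5$ and let $A \subset V$ with $|A| = 3$. Let $G_1, G_2, G_3$ be graphs on vertex set $V$ such that for all $i \ne j$, no edge of $G_i$ is disjoint from an edge of $G_j$. Then $\sum_{i=1}^3 \sum_{v \in A} \deg_{G_i}(v) \le 3(n+1)$.
   Context: $\deg_{G}(v)$ denotes the degree of vertex $v$ in the (simple) graph $G$. -}

module Defs where

open import Data.Nat using (ℕ; _+_)
open import Data.Fin using (Fin)
open import Data.List using (List; length; filter; allFin; sum; map)
open import Relation.Nullary using (¬_; Dec)
open import Relation.Binary.PropositionalEquality using (_≡_; _≢_)
open import Data.Product using (_×_)

record SimpleGraph (n : ℕ) : Set₁ where
  field
    Adj   : Fin n → Fin n → Set
    adj?  : (u v : Fin n) → Dec (Adj u v)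
    sym   : ∀ {u v} → Adj u v → Adj v u
    irrefl : ∀ {v} → ¬ Adj v v

open SimpleGraph public

deg : ∀ {n} → SimpleGraph n → Fin n → ℕ
deg G v = length (filter (adj? G v) (allFin _))

DisjointPairs : ∀ {n} → Fin n → Fin n → Fin n → Fin n → Set
DisjointPairs u v x y = u ≢ x × u ≢ y × v ≢ x × v ≢ y

NoDisjointEdges : ∀ {n} → SimpleGraph n → SimpleGraph n → Set
NoDisjointEdges G H = ∀ u v x y → Adj G u v → Adj H x y → ¬ DisjointPairs u v x y

degSum3 : ∀ {n} → SimpleGraph n → Fin n → Fin n → Fin n → ℕ
degSum3 G a b c = deg G a + deg G b + deg G c

module Submission where

-- Write A = {a, b, c}.  For a vertex w let weight(w) be the number of pairs
-- (i, x) with x ∈ A adjacent to w in Gᵢ; the quantity to bound is Σ_w weight(w).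
-- Two facts control how the weight is distributed.
--   * Heavy vertex: if p ∉ A has weight ≥ 4, then p has two neighbours x, y ∈ A
--     in some Gᵢ.  Any edge zq of another Gⱼ (z ∈ A, q ∉ A ∪ {p}) is disjoint
--     from px or from py, so it does not exist: every other q ∉ A weighs ≤ 3.
--   * Five vertices: for p, q ∉ A, the vertices a, b, c, p, q weigh at most
--     18.  An edge xy of Gᵢ inside A is disjoint from the edges zp, zq of Gⱼ
--     (z the third vertex of A), so each apex z ∈ A contributes at most 2 for
--     each pair (Gᵢ, Gⱼ); the pairs (G₁, G₂), (G₂, G₃), (G₃, G₁) give 18.
-- Taking w₁ ∉ A heavy if possible and any further w₂ ∉ A, every vertex except
-- a, b, c, w₁, w₂ weighs at most 3, and the total is ≤ 18 + 3(n − 5) = 3(n + 1).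

open import Defs
open import Data.Nat using (ℕ; _+_; _*_; _≤_)
open import Data.Fin using (Fin)
open import Relation.Binary.PropositionalEquality using (_≢_)

open import Data.Bool using (true; false; if_then_else_)
open import Data.Empty using (⊥-elim)
open import Data.Fin using (zero; suc)
open import Data.Fin.Properties using (any?; pigeonhole; ¬∀⟶∃¬)
  renaming (_≟_ to _≟ᶠ_; <⇒≢ to <⇒≢ᶠ)
open import Data.List using (List; []; _∷_; length; filter; tabulate; lookup; map)
open import Data.List.Membership.Propositional using (_∈_; _∉_)
import Data.List.Membership.DecPropositional as DecMembership
open import Data.List.Relation.Unary.All using (All; []; _∷_; all?)
open import Data.List.Relation.Unary.All.Properties using (¬Any⇒All¬)
open import Data.List.Relation.Unary.AllPairs using ([]; _∷_)
open import Data.List.Relation.Unary.Any using (index)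
open import Data.List.Relation.Unary.Any.Properties using (lookup-index)
open import Data.List.Relation.Unary.Unique.Propositional using (Unique)
open import Data.Nat using (zero; suc; z≤n; _<_; _≤?_)
open import Data.Nat.ListAction using () renaming (sum to sumᴸ)
open import Data.Nat.Properties
open import Algebra.Properties.CommutativeMonoid.Sum +-0-commutativeMonoid
  using (sum; ∑-distrib-+)
open import Algebra.Properties.CommutativeSemigroup +-commutativeSemigroup
  using (interchange)
open import Data.Nat.Tactic.RingSolver using (solve-∀)
open import Data.Product using (∃; _×_; _,_)
open import Data.Sum using (_⊎_; inj₁; inj₂)
open import Data.Vec.Functional using (updateAt)
open import Data.Vec.Functional.Properties using (updateAt-updates; updateAt-minimal)
open import Function using (_∘_; const)
open import Relation.Nullary using (¬_; Dec; yes; no; does; ¬?)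
open import Relation.Nullary.Decidable using (_×-dec_)
open import Relation.Binary.PropositionalEquality
  using (_≡_; refl; trans; cong; cong₂; ≢-sym; module ≡-Reasoning)

sum-mono : ∀ {n} {f g : Fin n → ℕ} → (∀ i → f i ≤ g i) → sum f ≤ sum g
sum-mono {zero}  f≤g = z≤n
sum-mono {suc n} f≤g = +-mono-≤ (f≤g zero) (sum-mono (f≤g ∘ suc))

sum-const : ∀ n k → sum {n} (const k) ≡ n * k
sum-const zero    k = refl
sum-const (suc n) k = cong (k +_) (sum-const n k)

sum-+₃ : ∀ {n} (f g h : Fin n → ℕ) →
  sum f + sum g + sum h ≡ sum (λ i → f i + g i + h i)
sum-+₃ f g h = begin
  sum f + sum g + sum h                ≡⟨ cong (_+ sum h) (∑-distrib-+ f g) ⟨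
  sum (λ i → f i + g i) + sum h        ≡⟨ ∑-distrib-+ (λ i → f i + g i) h ⟨
  sum (λ i → f i + g i + h i)          ∎
  where open ≡-Reasoning

sum-updateAt : ∀ {n} (f : Fin n → ℕ) (x : Fin n) (v : ℕ) →
  sum (updateAt f x (const v)) + f x ≡ sum f + v
sum-updateAt f zero v = swap v (sum (f ∘ suc)) (f zero)
  where
  swap : ∀ v s u → v + s + u ≡ u + s + v
  swap = solve-∀
sum-updateAt {suc n} f (suc x) v = begin
  f₀ + sum (updateAt f′ x (const v)) + f′ x    ≡⟨ +-assoc f₀ _ (f′ x) ⟩
  f₀ + (sum (updateAt f′ x (const v)) + f′ x)  ≡⟨ cong (f₀ +_) (sum-updateAt f′ x v) ⟩
  f₀ + (sum f′ + v)                            ≡⟨ +-assoc f₀ (sum f′) v ⟨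
  f₀ + sum f′ + v                              ∎
  where
  open ≡-Reasoning
  f₀ = f zero
  f′ = f ∘ suc

map-updateAt-avoiding : ∀ {n} (f : Fin n → ℕ) (x : Fin n) (v : ℕ) {xs : List (Fin n)} →
  All (x ≢_) xs → map (updateAt f x (const v)) xs ≡ map f xs
map-updateAt-avoiding f x v []                        = refl
map-updateAt-avoiding f x v {y ∷ _} (x≢y ∷ x∉ys) =
  cong₂ _∷_ (updateAt-minimal y x f (≢-sym x≢y)) (map-updateAt-avoiding f x v x∉ys)

-- If f ≤ B away from a list xs of distinct points, then
-- Σ f ≤ Σ_{x ∈ xs} f x + (n − |xs|) · B, written here without subtraction.
sum-bounded-off : ∀ {n} (B : ℕ) (f : Fin n → ℕ) (xs : List (Fin n)) → Unique xs →
  (∀ w → All (w ≢_) xs → f w ≤ B) → sum f + length xs * B ≤ sumᴸ (map f xs) + n * B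
sum-bounded-off {n} B f [] [] bounded = begin
  sum f + 0       ≡⟨ +-identityʳ (sum f) ⟩
  sum f           ≤⟨ sum-mono (λ w → bounded w []) ⟩
  sum {n} (const B) ≡⟨ sum-const n B ⟩
  n * B           ∎
  where open ≤-Reasoning
sum-bounded-off {n} B f (x ∷ xs) (x∉xs ∷ distinct) bounded = begin
  sum f + (B + length xs * B)           ≡⟨ +-assoc (sum f) B _ ⟨
  sum f + B + length xs * B             ≡⟨ cong (_+ length xs * B) (sum-updateAt f x B) ⟨
  sum f′ + f x + length xs * B          ≡⟨ cong (_+ length xs * B) (+-comm (sum f′) (f x)) ⟩
  f x + sum f′ + length xs * B          ≡⟨ +-assoc (f x) (sum f′) _ ⟩
  f x + (sum f′ + length xs * B)        ≤⟨ +-monoʳ-≤ (f x) (sum-bounded-off B f′ xs distinct bounded′) ⟩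
  f x + (sumᴸ (map f′ xs) + n * B)      ≡⟨ cong (λ ys → f x + (sumᴸ ys + n * B)) (map-updateAt-avoiding f x B x∉xs) ⟩
  f x + (sumᴸ (map f xs) + n * B)       ≡⟨ +-assoc (f x) _ (n * B) ⟨
  f x + sumᴸ (map f xs) + n * B         ∎
  where
  open ≤-Reasoning
  f′ = updateAt f x (const B)
  bounded′ : ∀ w → All (w ≢_) xs → f′ w ≤ B
  bounded′ w w∉xs with w ≟ᶠ x
  ... | yes refl = ≤-reflexive (updateAt-updates x f)
  ... | no w≢x   = ≤-trans (≤-reflexive (updateAt-minimal w x f w≢x)) (bounded w (w≢x ∷ w∉xs))

missing-vertex : ∀ {n} (xs : List (Fin n)) → length xs < n → ∃ λ w → w ∉ xs
missing-vertex {n} xs short = ¬∀⟶∃¬ n (_∈ xs) (_∈? xs) not-all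
  where
  open DecMembership (_≟ᶠ_ {n}) using (_∈?_)
  open ≡-Reasoning
  not-all : ¬ (∀ w → w ∈ xs)
  not-all all∈ with pigeonhole short (λ w → index (all∈ w))
  ... | i , j , i<j , same-index = <⇒≢ᶠ i<j (begin
    i                            ≡⟨ lookup-index (all∈ i) ⟩
    lookup xs (index (all∈ i))   ≡⟨ cong (lookup xs) same-index ⟩
    lookup xs (index (all∈ j))   ≡⟨ lookup-index (all∈ j) ⟨
    j                            ∎)

two-of-three : ∀ {x y z} → 4 ≤ x + y + z → 2 ≤ x ⊎ 2 ≤ y ⊎ 2 ≤ z
two-of-three {x} {y} {z} total with 2 ≤? x | 2 ≤? y | 2 ≤? z
... | yes x≥2 | _       | _       = inj₁ x≥2
... | no _    | yes y≥2 | _       = inj₂ (inj₁ y≥2)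
... | no _    | no _    | yes z≥2 = inj₂ (inj₂ z≥2)
... | no x≱2  | no y≱2  | no z≱2  =
  ⊥-elim (≤⇒≯ (+-mono-≤ (+-mono-≤ (≮⇒≥ x≱2) (≮⇒≥ y≱2)) (≮⇒≥ z≱2)) total)

close-count : ∀ {n total s} → total + 5 * 3 ≤ s + n * 3 → s ≤ 18 → total ≤ 3 * (n + 1)
close-count {n} {total} {s} counted s≤18 = +-cancelʳ-≤ 15 total (3 * (n + 1)) (begin
  total + 15     ≤⟨ counted ⟩
  s + n * 3      ≤⟨ +-monoˡ-≤ (n * 3) s≤18 ⟩
  18 + n * 3     ≡⟨ rearrange n ⟩
  3 * (n + 1) + 15 ∎)
  where
  open ≤-Reasoning
  rearrange : ∀ n → 18 + n * 3 ≡ 3 * (n + 1) + 15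
  rearrange = solve-∀

χ : ∀ {n} → SimpleGraph n → Fin n → Fin n → ℕ
χ G v w = if does (adj? G v w) then 1 else 0

χ≤1 : ∀ {n} (G : SimpleGraph n) v w → χ G v w ≤ 1
χ≤1 G v w with does (adj? G v w)
... | true  = ≤-refl
... | false = z≤n

χ-irrefl : ∀ {n} (G : SimpleGraph n) v → χ G v v ≡ 0
χ-irrefl G v with adj? G v v
... | yes loop = ⊥-elim (irrefl G loop)
... | no _     = refl

χ-conflict : ∀ {n} {G H : SimpleGraph n} {u v x y} → NoDisjointEdges G H →
  DisjointPairs u v x y → χ G u v + χ H x y ≤ 1
χ-conflict {G = G} {H} {u} {v} {x} {y} no-disjoint uv∥xy with adj? G u v | adj? H x y
... | yes uv | yes xy = ⊥-elim (no-disjoint u v x y uv xy uv∥xy)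
... | yes _  | no _   = ≤-refl
... | no _   | yes _  = ≤-refl
... | no _   | no _   = z≤n

length-filter-tabulate : ∀ {n} {A : Set} {P : A → Set} (P? : ∀ x → Dec (P x)) (g : Fin n → A) →
  length (filter P? (tabulate g)) ≡ sum (λ i → if does (P? (g i)) then 1 else 0)
length-filter-tabulate {zero}  P? g = refl
length-filter-tabulate {suc n} P? g with does (P? (g zero))
... | true  = cong suc (length-filter-tabulate P? (g ∘ suc))
... | false = length-filter-tabulate P? (g ∘ suc)

deg-as-sum : ∀ {n} (G : SimpleGraph n) v → deg G v ≡ sum (χ G v)
deg-as-sum G v = length-filter-tabulate (adj? G v) (λ w → w)

opposite-silenced : ∀ {n} {G H : SimpleGraph n} {x y z p q} → NoDisjointEdges G H →
  DisjointPairs x p z q → DisjointPairs y p z q →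
  2 ≤ χ G z p + (χ G x p + χ G y p) → χ H z q ≡ 0
opposite-silenced {G = G} {H} {x} {y} {z} {p} {q} no-disjoint xp∥zq yp∥zq two with adj? H z q
... | no _   = refl
... | yes zq with adj? G x p | adj? G y p
...   | yes xp | _      = ⊥-elim (no-disjoint x p z q xp zq xp∥zq)
...   | no _   | yes yp = ⊥-elim (no-disjoint y p z q yp zq yp∥zq)
...   | no _   | no _   = ⊥-elim (≤⇒≯ (≤-trans (≤-reflexive (+-identityʳ _)) (χ≤1 G z p)) two)

apex-bound : ∀ {n} {G H : SimpleGraph n} {x y z p q} → NoDisjointEdges G H →
  DisjointPairs x y z p → DisjointPairs y x z q →
  (χ G x y + χ G y x) + (χ H z p + χ H z q) ≤ 2
apex-bound {G = G} {H} {x} {y} {z} {p} {q} no-disjoint xy∥zp yx∥zq =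
  ≤-trans (≤-reflexive (interchange (χ G x y) (χ G y x) (χ H z p) (χ H z q)))
          (+-mono-≤ (χ-conflict {G = G} {H} no-disjoint xy∥zp) (χ-conflict {G = G} {H} no-disjoint yx∥zq))

module Triple {n} {a b c : Fin n} (a≢b : a ≢ b) (a≢c : a ≢ c) (b≢c : b ≢ c) where

  A : List (Fin n)
  A = a ∷ b ∷ c ∷ []

  A-distinct : Unique A
  A-distinct = (a≢b ∷ a≢c ∷ []) ∷ (b≢c ∷ []) ∷ [] ∷ []

  Outside : Fin n → Set
  Outside w = All (w ≢_) A

  outside? : ∀ w → Dec (Outside w)
  outside? w = all? (λ x → ¬? (w ≟ᶠ x)) A

  nbrs : SimpleGraph n → Fin n → ℕ
  nbrs G w = χ G a w + χ G b w + χ G c w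

  nbrs≤3 : ∀ G w → nbrs G w ≤ 3
  nbrs≤3 G w = +-mono-≤ (+-mono-≤ (χ≤1 G a w) (χ≤1 G b w)) (χ≤1 G c w)

  degSum-as-sum : ∀ G → degSum3 G a b c ≡ sum (nbrs G)
  degSum-as-sum G = trans
    (cong₂ _+_ (cong₂ _+_ (deg-as-sum G a) (deg-as-sum G b)) (deg-as-sum G c))
    (sum-+₃ (χ G a) (χ G b) (χ G c))

  heavy-silences : ∀ {G H p q} → NoDisjointEdges G H → Outside p → Outside q → p ≢ q →
    2 ≤ nbrs G p → nbrs H q ≡ 0
  heavy-silences {G} {H} {p} {q} no-disjoint (p≢a ∷ p≢b ∷ p≢c ∷ []) (q≢a ∷ q≢b ∷ q≢c ∷ []) p≢q heavy =
    cong₂ _+_ (cong₂ _+_ silenced-a silenced-b) silenced-c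
    where
    rotate-b : ∀ x y z → x + y + z ≡ y + (x + z)
    rotate-b = solve-∀
    rotate-c : ∀ x y z → x + y + z ≡ z + (x + y)
    rotate-c = solve-∀
    heavy-as : ∀ {r} → nbrs G p ≡ r → 2 ≤ r
    heavy-as eq = ≤-trans heavy (≤-reflexive eq)
    silenced-a : χ H a q ≡ 0
    silenced-a = opposite-silenced {G = G} {H} no-disjoint
      (≢-sym a≢b , ≢-sym q≢b , p≢a , p≢q) (≢-sym a≢c , ≢-sym q≢c , p≢a , p≢q)
      (heavy-as (+-assoc (χ G a p) _ _))
    silenced-b : χ H b q ≡ 0
    silenced-b = opposite-silenced {G = G} {H} no-disjoint
      (a≢b , ≢-sym q≢a , p≢b , p≢q) (≢-sym b≢c , ≢-sym q≢c , p≢b , p≢q)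
      (heavy-as (rotate-b (χ G a p) _ _))
    silenced-c : χ H c q ≡ 0
    silenced-c = opposite-silenced {G = G} {H} no-disjoint
      (a≢c , ≢-sym q≢a , p≢c , p≢q) (b≢c , ≢-sym q≢b , p≢c , p≢q)
      (heavy-as (rotate-c (χ G a p) _ _))

  inside : SimpleGraph n → ℕ
  inside G = nbrs G a + nbrs G b + nbrs G c

  toPair : SimpleGraph n → Fin n → Fin n → ℕ
  toPair H p q = nbrs H p + nbrs H q

  -- Regrouping by the vertex z ∈ A opposite to the pair xy inside A.
  apex-decomposition : ∀ G H p q → inside G + toPair H p q ≡
      (χ G b c + χ G c b) + (χ H a p + χ H a q)
    + ((χ G a c + χ G c a) + (χ H b p + χ H b q))
    + ((χ G a b + χ G b a) + (χ H c p + χ H c q))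
  apex-decomposition G H p q rewrite χ-irrefl G a | χ-irrefl G b | χ-irrefl G c =
    regroup (χ G b a) (χ G c a) (χ G a b) (χ G c b) (χ G a c) (χ G b c)
            (χ H a p) (χ H b p) (χ H c p) (χ H a q) (χ H b q) (χ H c q)
    where
    regroup : ∀ ba ca ab cb ac bc ap bp cp aq bq cq →
      (0 + ba + ca) + (ab + 0 + cb) + (ac + bc + 0) + ((ap + bp + cp) + (aq + bq + cq))
      ≡ (bc + cb) + (ap + aq) + ((ac + ca) + (bp + bq)) + ((ab + ba) + (cp + cq))
    regroup = solve-∀

  -- Cross bound: the edges of G inside A and of H from A to p, q ∉ A number
  -- at most 6, two per apex z ∈ A.
  cross-bound : ∀ {G H p q} → NoDisjointEdges G H → Outside p → Outside q →
    inside G + toPair H p q ≤ 6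
  cross-bound {G} {H} {p} {q} no-disjoint (p≢a ∷ p≢b ∷ p≢c ∷ []) (q≢a ∷ q≢b ∷ q≢c ∷ []) =
    ≤-trans (≤-reflexive (apex-decomposition G H p q))
      (+-mono-≤ (+-mono-≤
        (apex-bound {G = G} {H} no-disjoint
          (≢-sym a≢b , ≢-sym p≢b , ≢-sym a≢c , ≢-sym p≢c)
          (≢-sym a≢c , ≢-sym q≢c , ≢-sym a≢b , ≢-sym q≢b))
        (apex-bound {G = G} {H} no-disjoint
          (a≢b , ≢-sym p≢a , ≢-sym b≢c , ≢-sym p≢c)
          (≢-sym b≢c , ≢-sym q≢c , a≢b , ≢-sym q≢a)))
        (apex-bound {G = G} {H} no-disjoint
          (a≢c , ≢-sym p≢a , b≢c , ≢-sym p≢b)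
          (b≢c , ≢-sym q≢b , a≢c , ≢-sym q≢a)))

  module Weights (G₁ G₂ G₃ : SimpleGraph n)
    (N₁₂ : NoDisjointEdges G₁ G₂) (N₂₁ : NoDisjointEdges G₂ G₁)
    (N₁₃ : NoDisjointEdges G₁ G₃) (N₃₁ : NoDisjointEdges G₃ G₁)
    (N₂₃ : NoDisjointEdges G₂ G₃) (N₃₂ : NoDisjointEdges G₃ G₂) where

    weight : Fin n → ℕ
    weight w = nbrs G₁ w + nbrs G₂ w + nbrs G₃ w

    degSums-as-sum : degSum3 G₁ a b c + degSum3 G₂ a b c + degSum3 G₃ a b c ≡ sum weight
    degSums-as-sum = trans
      (cong₂ _+_ (cong₂ _+_ (degSum-as-sum G₁) (degSum-as-sum G₂)) (degSum-as-sum G₃))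
      (sum-+₃ (nbrs G₁) (nbrs G₂) (nbrs G₃))

    heavy-vertex : ∀ {p q} → Outside p → Outside q → p ≢ q → 4 ≤ weight p → weight q ≤ 3
    heavy-vertex {p} {q} out-p out-q p≢q heavy = via-heavy-graph (two-of-three heavy)
      where
      silent : ∀ {G H} → NoDisjointEdges G H → 2 ≤ nbrs G p → nbrs H q ≤ 0
      silent {G} {H} no-disjoint h = ≤-reflexive (heavy-silences {G} {H} no-disjoint out-p out-q p≢q h)
      via-heavy-graph : 2 ≤ nbrs G₁ p ⊎ 2 ≤ nbrs G₂ p ⊎ 2 ≤ nbrs G₃ p → weight q ≤ 3
      via-heavy-graph (inj₁ h₁) = +-mono-≤
        (+-mono-≤ (nbrs≤3 G₁ q) (silent {G₁} {G₂} N₁₂ h₁)) (silent {G₁} {G₃} N₁₃ h₁)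
      via-heavy-graph (inj₂ (inj₁ h₂)) = +-mono-≤
        (+-mono-≤ (silent {G₂} {G₁} N₂₁ h₂) (nbrs≤3 G₂ q)) (silent {G₂} {G₃} N₂₃ h₂)
      via-heavy-graph (inj₂ (inj₂ h₃)) = +-mono-≤
        (+-mono-≤ (silent {G₃} {G₁} N₃₁ h₃) (silent {G₃} {G₂} N₃₂ h₃)) (nbrs≤3 G₃ q)

    exceptional-vertex : 3 < n →
      ∃ λ w₁ → Outside w₁ × (∀ w → Outside w → w ≢ w₁ → weight w ≤ 3)
    exceptional-vertex 3<n with any? (λ w → outside? w ×-dec (4 ≤? weight w))
    ... | yes (w₁ , out₁ , heavy) =
      w₁ , out₁ , λ w out w≢w₁ → heavy-vertex out₁ out (≢-sym w≢w₁) heavy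
    ... | no no-heavy with missing-vertex A 3<n
    ...   | w₁ , w₁∉A =
      w₁ , ¬Any⇒All¬ A w₁∉A , λ w out _ → ≮⇒≥ (λ heavy → no-heavy (w , out , heavy))

    five-vertex-bound : ∀ {p q} → Outside p → Outside q → sumᴸ (map weight (q ∷ p ∷ A)) ≤ 18
    five-vertex-bound {p} {q} out-p out-q = ≤-trans
      (≤-reflexive (regroup (nbrs G₁ a) (nbrs G₂ a) (nbrs G₃ a) (nbrs G₁ b) (nbrs G₂ b) (nbrs G₃ b)
                            (nbrs G₁ c) (nbrs G₂ c) (nbrs G₃ c) (nbrs G₁ p) (nbrs G₂ p) (nbrs G₃ p)
                            (nbrs G₁ q) (nbrs G₂ q) (nbrs G₃ q)))
      (+-mono-≤ (+-mono-≤ (cross-bound {G₁} {G₂} N₁₂ out-p out-q) (cross-bound {G₂} {G₃} N₂₃ out-p out-q))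
                (cross-bound {G₃} {G₁} N₃₁ out-p out-q))
      where
      regroup : ∀ a₁ a₂ a₃ b₁ b₂ b₃ c₁ c₂ c₃ p₁ p₂ p₃ q₁ q₂ q₃ →
        q₁ + q₂ + q₃ + (p₁ + p₂ + p₃ + (a₁ + a₂ + a₃ + (b₁ + b₂ + b₃ + (c₁ + c₂ + c₃ + 0))))
        ≡ (a₁ + b₁ + c₁ + (p₂ + q₂)) + (a₂ + b₂ + c₂ + (p₃ + q₃)) + (a₃ + b₃ + c₃ + (p₁ + q₁))
      regroup = solve-∀

    -- Total weight: only a, b, c, w₁ and some w₂ ∉ A ∪ {w₁} may exceed 3.
    total-weight-bound : 5 ≤ n → sum weight ≤ 3 * (n + 1)
    total-weight-bound 5≤n with exceptional-vertex (≤-trans (n≤1+n 4) 5≤n)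
    ... | w₁ , out₁ , light with missing-vertex (w₁ ∷ A) 5≤n
    ...   | w₂ , w₂∉ with ¬Any⇒All¬ (w₁ ∷ A) w₂∉
    ...     | w₂≢w₁ ∷ out₂ = close-count {n}
      (sum-bounded-off 3 weight (w₂ ∷ w₁ ∷ A) distinct light-elsewhere)
      (five-vertex-bound out₁ out₂)
      where
      distinct : Unique (w₂ ∷ w₁ ∷ A)
      distinct = (w₂≢w₁ ∷ out₂) ∷ out₁ ∷ A-distinct
      light-elsewhere : ∀ w → All (w ≢_) (w₂ ∷ w₁ ∷ A) → weight w ≤ 3
      light-elsewhere w (_ ∷ w≢w₁ ∷ out) = light w out w≢w₁

lemma2p4 : (n : ℕ) → 5 ≤ n → (a b c : Fin n) → a ≢ b → a ≢ c → b ≢ c →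
    (G₁ G₂ G₃ : SimpleGraph n) →
    NoDisjointEdges G₁ G₂ → NoDisjointEdges G₂ G₁ →
    NoDisjointEdges G₁ G₃ → NoDisjointEdges G₃ G₁ →
    NoDisjointEdges G₂ G₃ → NoDisjointEdges G₃ G₂ →
    degSum3 G₁ a b c + degSum3 G₂ a b c + degSum3 G₃ a b c ≤ 3 * (n + 1)
lemma2p4 n 5≤n a b c a≢b a≢c b≢c G₁ G₂ G₃ N₁₂ N₂₁ N₁₃ N₃₁ N₂₃ N₃₂ =
  ≤-trans (≤-reflexive degSums-as-sum) (total-weight-bound 5≤n)
  where open Triple.Weights a≢b a≢c b≢c G₁ G₂ G₃ N₁₂ N₂₁ N₁₃ N₃₁ N₂₃ N₃₂
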